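{- Let $G=(V,E)$ be a finite chordal graph and $n\geq 1$ an integer. Then $C(I_n(G))\leq n-1$.
   Context: Graphs are finite, simple and undirected. A graph is chordal if it contains no induced cycle of length at least $4$. For a graph $G=(V,E)$ and an integer $n\geq 1$, $I_n(G)$ is the simplicial complex $\{U\subseteq V:\ \alpha(G[U])<n\}$, where $G[U]$ is the induced subgraph and $\alpha$ denotes the independence number (maximum size of a set of pairwise non-adjacent vertices). For a finite simplicial complex $X$, a face $\sigma$ contained in a unique maximal face $\tau$ is a free face; if $|\sigma|\leq d$, removing all faces $\eta$ with $\sigma\subseteq\eta\subseteq\tau$ is an elementary $d$-collapse. $X$ is $d$-collapsible if a sequence of elementary $d$-collapses reduces it to the void complex (the complex with no faces, not even $\emptyset$). The collapsibility number $C(X)$ is the minimum $d$ such that $X$ is $d$-collapsible. -}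

module Defs where

open import Data.Nat using (ℕ; zero; suc; _≤_; _<_; _∸_)
open import Data.Bool using (Bool; true; false)
open import Data.Fin using (Fin; toℕ)
open import Data.Fin.Subset using (Subset; _⊆_; _∈_; ∣_∣)
open import Data.Product using (Σ; _×_; ∃; ∃-syntax)
open import Data.Sum using (_⊎_)
open import Relation.Nullary using (¬_)
open import Relation.Binary.PropositionalEquality using (_≡_; _≢_)
open import Level using () renaming (suc to lsuc; zero to lzero)

record Graph (m : ℕ) : Set where
  field
    adj     : Fin m → Fin m → Bool
    symm    : ∀ u v → adj u v ≡ adj v u
    irrefl  : ∀ v → adj v v ≡ false

open Graph public

Adj : ∀ {m} → Graph m → Fin m → Fin m → Set
Adj G u v = adj G u v ≡ true

CycNbr : (k : ℕ) → Fin k → Fin k → Set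
CycNbr k i j =
  (toℕ j ≡ suc (toℕ i)) ⊎ (toℕ i ≡ suc (toℕ j)) ⊎
  ((toℕ i ≡ 0 × toℕ j ≡ k ∸ 1) ⊎ (toℕ j ≡ 0 × toℕ i ≡ k ∸ 1))

IsInducedCycle : ∀ {m} → Graph m → (k : ℕ) → (Fin k → Fin m) → Set
IsInducedCycle G k c =
  (∀ i j → c i ≡ c j → i ≡ j) ×
  (∀ i j → (Adj G (c i) (c j) → CycNbr k i j) × (CycNbr k i j → Adj G (c i) (c j)))

Chordal : ∀ {m} → Graph m → Set
Chordal {m} G = ∀ (k : ℕ) → 4 ≤ k → (c : Fin k → Fin m) → ¬ IsInducedCycle G k c

-- Independence complex I_n(G) = { U : α(G[U]) < n }

IndepIn : ∀ {m} → Graph m → Subset m → Subset m → Set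
IndepIn G U S = S ⊆ U × (∀ u v → u ∈ S → v ∈ S → ¬ Adj G u v)

αLess : ∀ {m} → Graph m → Subset m → ℕ → Set
αLess G U n = ∀ S → IndepIn G U S → ∣ S ∣ < n

Complex : ℕ → Set₁
Complex m = Subset m → Set

I : ∀ {m} → ℕ → Graph m → Complex m
I n G U = αLess G U n

IsMaximal : ∀ {m} → Complex m → Subset m → Set
IsMaximal X τ = X τ × (∀ η → X η → τ ⊆ η → η ≡ τ)

FreeIn : ∀ {m} → Complex m → Subset m → Subset m → Set
FreeIn X σ τ =
  X σ × σ ⊆ τ × IsMaximal X τ × (∀ ρ → IsMaximal X ρ → σ ⊆ ρ → ρ ≡ τ)

Remove : ∀ {m} → Complex m → Subset m → Subset m → Complex m
Remove X σ τ η = X η × ¬ (σ ⊆ η × η ⊆ τ)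

-- the void complex (no faces, not even ∅)
Void : ∀ {m} → Complex m → Set
Void X = ∀ σ → ¬ X σ

data Collapsible {m : ℕ} (d : ℕ) : Complex m → Set₁ where
  done : ∀ {X} → Void X → Collapsible d X
  step : ∀ {X} (σ τ : Subset m) → FreeIn X σ τ → ∣ σ ∣ ≤ d →
         Collapsible d (Remove X σ τ) → Collapsible d X

-- C(X) ≤ d : X is d'-collapsible for some d' ≤ d (C(X) is the least such d')
CollapsibilityAtMost : ∀ {m} → Complex m → ℕ → Set₁
CollapsibilityAtMost X d = ∃[ d' ] (d' ≤ d × Collapsible d' X)

-- For disjoint W and A let K(W, A, n) be the join of I_n(G[W]) with the full simplex on A. If v is
-- simplicial in G[W], the deletion of v from K(W, A, n) is K(W - v, A, n) and its link is
-- K(W', A', n - 1), where W' consists of the vertices of W apart from v and A' adds to A the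
-- neighbours of v in W: an independent set of G[W'] together with v is independent, while v and its
-- neighbours in W form a clique and so meet an independent set in at most one vertex. Collapses of
-- a (d - 1)-collapsible link lift to the whole complex by adding v to both faces, after which only
-- the deletion is left; so K(W, A, n + 1) is n-collapsible, by induction on n and |W|.
-- Chordal graphs supply the simplicial vertices (Dirac's lemma), and I_{n+1}(G) = K(V, ∅, n + 1).

module Submission where

open import Defs
open import Level using (0ℓ)
open import Data.Bool using (true)
open import Data.Bool.Properties using () renaming (_≟_ to _≟ᵇ_)
open import Data.Nat using (ℕ; zero; suc; _≤_; _<_; _∸_; _+_; z≤n; s≤s)
open import Data.Nat.Properties
  using (≤-refl; ≤-trans; ≤-reflexive; ≤-pred; <-irrefl; +-monoˡ-≤; +-mono-≤; +-suc; +-comm;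
         suc-injective; module ≤-Reasoning)
open import Data.Fin using (Fin; zero; suc; toℕ; fromℕ)
open import Data.Fin.Properties using (any?; toℕ-injective; toℕ-fromℕ) renaming (_≟_ to _≟ᶠ_)
open import Data.Fin.Subset
open import Data.Fin.Subset.Properties
open import Data.Fin.Subset.Induction using (Acc; acc; ⊂-wellFounded; ⊃-wellFounded)
open import Data.Vec using ([]; _∷_; there; tabulate)
open import Data.Vec.Properties using (lookup⇒[]=; []=⇒lookup; lookup∘tabulate)
open import Data.List using (List; []; _∷_; _++_; length; lookup)
open import Data.List.Relation.Unary.All using (All; []; _∷_) renaming (lookup to lookupᴬ; map to mapᴬ)
open import Data.List.Relation.Unary.All.Properties using (¬Any⇒All¬; ++⁺)
open import Data.List.Relation.Unary.Any using (Any; here; there) renaming (any? to anyˡ?)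
open import Data.List.Membership.Propositional.Properties using (∈-lookup)
open import Data.Product using (_×_; _,_; proj₁; proj₂; ∃-syntax)
import Data.Product as Product
open import Data.Sum using (_⊎_; inj₁; inj₂; [_,_]′)
import Data.Sum as Sum
open import Function using (id; _∘_)
open import Relation.Nullary using (¬_; Dec; yes; no; does; contradiction; ¬?)
open import Relation.Nullary.Decidable using (dec-true; decidable-stable; _×-dec_; _⊎-dec_)
open import Relation.Unary using (Pred; Decidable; _≐_)
open import Relation.Unary.Properties using (≐-sym; ≐-trans)
open import Relation.Binary.PropositionalEquality

private
  variable
    m : ℕ
    p q : Subset m
    x y : Fin m

-- Subsets

select : {P : Pred (Fin m) 0ℓ} → Decidable P → Subset m
select P? = tabulate (λ x → does (P? x))

module _ {P : Pred (Fin m) 0ℓ} (P? : Decidable P) where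

  ∈-select⁺ : ∀ {x} → P x → x ∈ select P?
  ∈-select⁺ {x} px = lookup⇒[]= x _ (trans (lookup∘tabulate _ x) (dec-true (P? x) px))

  ∈-select⁻ : ∀ {x} → x ∈ select P? → P x
  ∈-select⁻ {x} x∈ with P? x | trans (sym (lookup∘tabulate (λ x → does (P? x)) x)) ([]=⇒lookup x∈)
  ... | yes px | _ = px
  ... | no _   | ()

x∈p─q⇒x∉q : ∀ (p q : Subset m) {x} → x ∈ p ─ q → x ∉ q
x∈p─q⇒x∉q (_ ∷ p) (inside  ∷ q) {zero}  ()
x∈p─q⇒x∉q (_ ∷ p) (outside ∷ q) {zero}  _          ()
x∈p─q⇒x∉q (_ ∷ p) (_       ∷ q) {suc x} (there x∈) x∈q = x∈p─q⇒x∉q p q x∈ (drop-there x∈q)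

∣p∣≤∣p∩q∣+∣p─q∣ : ∀ (p q : Subset m) → ∣ p ∣ ≤ ∣ p ∩ q ∣ + ∣ p ─ q ∣
∣p∣≤∣p∩q∣+∣p─q∣ []            []            = z≤n
∣p∣≤∣p∩q∣+∣p─q∣ (inside  ∷ p) (inside  ∷ q) = s≤s (∣p∣≤∣p∩q∣+∣p─q∣ p q)
∣p∣≤∣p∩q∣+∣p─q∣ (inside  ∷ p) (outside ∷ q) =
  ≤-trans (s≤s (∣p∣≤∣p∩q∣+∣p─q∣ p q)) (≤-reflexive (sym (+-suc _ _)))
∣p∣≤∣p∩q∣+∣p─q∣ (outside ∷ p) (inside  ∷ q) = ∣p∣≤∣p∩q∣+∣p─q∣ p q
∣p∣≤∣p∩q∣+∣p─q∣ (outside ∷ p) (outside ∷ q) = ∣p∣≤∣p∩q∣+∣p─q∣ p q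

p-y⊆p : p - y ⊆ p
p-y⊆p {p = p} {y = y} = p─q⊆p p ⁅ y ⁆

x∈p-y⇒x≢y : x ∈ p - y → x ≢ y
x∈p-y⇒x≢y {p = p} {y = y} x∈ = x∉⁅y⁆⇒x≢y (x∈p─q⇒x∉q p ⁅ y ⁆ x∈)

x∈p∪⁅y⁆⁻ : x ∈ p ∪ ⁅ y ⁆ → x ∈ p ⊎ x ≡ y
x∈p∪⁅y⁆⁻ {p = p} {y = y} x∈ = Sum.map₂ (x∈⁅y⁆⇒x≡y y) (x∈p∪q⁻ p ⁅ y ⁆ x∈)

x∈p∪⁅y⁆∧x≢y⇒x∈p : x ∈ p ∪ ⁅ y ⁆ → x ≢ y → x ∈ p
x∈p∪⁅y⁆∧x≢y⇒x∈p x∈ x≢y = [ id , (λ x≡y → contradiction x≡y x≢y) ]′ (x∈p∪⁅y⁆⁻ x∈)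

y∉p-y : y ∉ p - y
y∉p-y y∈ = x∈p-y⇒x≢y y∈ refl

p⊆p∪⁅y⁆ : p ⊆ p ∪ ⁅ y ⁆
p⊆p∪⁅y⁆ {y = y} = p⊆p∪q ⁅ y ⁆

y∈p∪⁅y⁆ : y ∈ p ∪ ⁅ y ⁆
y∈p∪⁅y⁆ {y = y} = x∈p∪q⁺ (inj₂ (x∈⁅x⁆ y))

p⊆q∧y∉p⇒p⊆q-y : p ⊆ q → y ∉ p → p ⊆ q - y
p⊆q∧y∉p⇒p⊆q-y p⊆q y∉p x∈p = x∈p∧x≢y⇒x∈p-y (p⊆q x∈p) (λ { refl → y∉p x∈p })

p-y⊆q⇒p⊆q∪⁅y⁆ : p - y ⊆ q → p ⊆ q ∪ ⁅ y ⁆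
p-y⊆q⇒p⊆q∪⁅y⁆ {y = y} p-y⊆q {x} x∈p with x ≟ᶠ y
... | yes refl = y∈p∪⁅y⁆
... | no x≢y   = p⊆p∪⁅y⁆ (p-y⊆q (x∈p∧x≢y⇒x∈p-y x∈p x≢y))

p⊆q∧y∈q⇒p∪⁅y⁆⊆q : p ⊆ q → y ∈ q → p ∪ ⁅ y ⁆ ⊆ q
p⊆q∧y∈q⇒p∪⁅y⁆⊆q p⊆q y∈q x∈ = [ p⊆q , (λ { refl → y∈q }) ]′ (x∈p∪⁅y⁆⁻ x∈)

∪⁅⁆-mono : p ⊆ q → p ∪ ⁅ y ⁆ ⊆ q ∪ ⁅ y ⁆
∪⁅⁆-mono p⊆q = p⊆q∧y∈q⇒p∪⁅y⁆⊆q (⊆-trans p⊆q p⊆p∪⁅y⁆) y∈p∪⁅y⁆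

∪⁅⁆-cancel : y ∉ p → p ∪ ⁅ y ⁆ ⊆ q ∪ ⁅ y ⁆ → p ⊆ q
∪⁅⁆-cancel y∉p p⊆q x∈p = x∈p∪⁅y⁆∧x≢y⇒x∈p (p⊆q (p⊆p∪⁅y⁆ x∈p)) (λ { refl → y∉p x∈p })

p-y∪⁅y⁆≡p : y ∈ p → (p - y) ∪ ⁅ y ⁆ ≡ p
p-y∪⁅y⁆≡p y∈p = ⊆-antisym (p⊆q∧y∈q⇒p∪⁅y⁆⊆q p-y⊆p y∈p) (p-y⊆q⇒p⊆q∪⁅y⁆ ⊆-refl)

p∪⁅y⁆-y⊆p : (p ∪ ⁅ y ⁆) - y ⊆ p
p∪⁅y⁆-y⊆p x∈ = x∈p∪⁅y⁆∧x≢y⇒x∈p (p-y⊆p x∈) (x∈p-y⇒x≢y x∈)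

p∪⁅y⁆-y≡p : y ∉ p → (p ∪ ⁅ y ⁆) - y ≡ p
p∪⁅y⁆-y≡p y∉p = ⊆-antisym p∪⁅y⁆-y⊆p (p⊆q∧y∉p⇒p⊆q-y p⊆p∪⁅y⁆ y∉p)

p∩q⊆p∩q-y : y ∉ p → p ∩ q ⊆ p ∩ (q - y)
p∩q⊆p∩q-y {p = p} {q} y∉p x∈ with x∈p∩q⁻ p q x∈
... | x∈p , x∈q = x∈p∩q⁺ (x∈p , x∈p∧x≢y⇒x∈p-y x∈q λ { refl → y∉p x∈p })

∪-mono : ∀ {p p′ q q′ : Subset m} → p ⊆ p′ → q ⊆ q′ → p ∪ q ⊆ p′ ∪ q′
∪-mono p⊆p′ q⊆q′ x∈ = x∈p∪q⁺ (Sum.map p⊆p′ q⊆q′ (x∈p∪q⁻ _ _ x∈))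

∩-mono : ∀ {p p′ q q′ : Subset m} → p ⊆ p′ → q ⊆ q′ → p ∩ q ⊆ p′ ∩ q′
∩-mono p⊆p′ q⊆q′ x∈ = x∈p∩q⁺ (Product.map p⊆p′ q⊆q′ (x∈p∩q⁻ _ _ x∈))

Empty⇒∣p∣≡0 : Empty p → ∣ p ∣ ≡ 0
Empty⇒∣p∣≡0 {m} p-empty = trans (cong ∣_∣ (Empty-unique p-empty)) (∣⊥∣≡0 m)

∣p∣≤1+∣p-y∣ : ∀ (p : Subset m) y → ∣ p ∣ ≤ suc ∣ p - y ∣
∣p∣≤1+∣p-y∣ p y = ≤-trans (∣p∣≤∣p∩q∣+∣p─q∣ p ⁅ y ⁆)
  (+-monoˡ-≤ ∣ p - y ∣ (≤-trans (∣p∩q∣≤∣q∣ p ⁅ y ⁆) (≤-reflexive (∣⁅x⁆∣≡1 y))))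

∣p∪⁅y⁆∣≤1+∣p∣ : ∀ (p : Subset m) y → ∣ p ∪ ⁅ y ⁆ ∣ ≤ suc ∣ p ∣
∣p∪⁅y⁆∣≤1+∣p∣ p y = ≤-trans (∣p∣≤1+∣p-y∣ (p ∪ ⁅ y ⁆) y)
  (s≤s (p⊆q⇒∣p∣≤∣q∣ (p∪⁅y⁆-y⊆p {p = p} {y = y})))

∣p∣≤1 : (∀ {x y} → x ∈ p → y ∈ p → x ≡ y) → ∣ p ∣ ≤ 1
∣p∣≤1 {p = p} all-equal with nonempty? p
... | no p-empty = ≤-trans (≤-reflexive (Empty⇒∣p∣≡0 p-empty)) z≤n
... | yes (x , x∈p) = ≤-trans (∣p∣≤1+∣p-y∣ p x) (s≤s (≤-reflexive (Empty⇒∣p∣≡0 p-x-empty)))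
  where
  p-x-empty : Empty (p - x)
  p-x-empty (y , y∈) = x∈p-y⇒x≢y y∈ (all-equal (p-y⊆p y∈) x∈p)

-- Collapses

module _ {m : ℕ} where

  Simplex : Subset m → Complex m
  Simplex A U = U ⊆ A

  Link : Complex m → Fin m → Complex m
  Link X v η = v ∉ η × X (η ∪ ⁅ v ⁆)

  Del : Complex m → Fin m → Complex m
  Del X v η = v ∉ η × X η

  IsMaximal-resp-≐ : ∀ {X Y : Complex m} {τ} → X ≐ Y → IsMaximal X τ → IsMaximal Y τ
  IsMaximal-resp-≐ (X⊆Y , Y⊆X) (Xτ , τ-max) = X⊆Y Xτ , λ η Yη → τ-max η (Y⊆X Yη)

  FreeIn-resp-≐ : ∀ {X Y : Complex m} {σ τ} → X ≐ Y → FreeIn X σ τ → FreeIn Y σ τ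
  FreeIn-resp-≐ X≐Y (Xσ , σ⊆τ , τ-max , τ-unique) =
    proj₁ X≐Y Xσ , σ⊆τ , IsMaximal-resp-≐ X≐Y τ-max ,
    λ ρ ρ-max → τ-unique ρ (IsMaximal-resp-≐ (≐-sym X≐Y) ρ-max)

  Remove-resp-≐ : ∀ {X Y : Complex m} {σ τ} → X ≐ Y → Remove X σ τ ≐ Remove Y σ τ
  Remove-resp-≐ (X⊆Y , Y⊆X) = Product.map₁ X⊆Y , Product.map₁ Y⊆X

  Collapsible-resp-≐ : ∀ {d} {X Y : Complex m} → X ≐ Y → Collapsible d X → Collapsible d Y
  Collapsible-resp-≐ (_ , Y⊆X) (done X-void) = done (λ σ Yσ → X-void σ (Y⊆X Yσ))
  Collapsible-resp-≐ X≐Y (step σ τ free ∣σ∣≤d rest) =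
    step σ τ (FreeIn-resp-≐ X≐Y free) ∣σ∣≤d (Collapsible-resp-≐ (Remove-resp-≐ X≐Y) rest)

  Collapsible-Simplex : ∀ {d} A → Collapsible d (Simplex A)
  Collapsible-Simplex A = step ⊥ A free (≤-trans (≤-reflexive (∣⊥∣≡0 m)) z≤n) (done nothing-left)
    where
    A-max : IsMaximal (Simplex A) A
    A-max = ⊆-refl , λ η η⊆A A⊆η → ⊆-antisym η⊆A A⊆η

    free : FreeIn (Simplex A) ⊥ A
    free = ⊥⊆ , ⊥⊆ , A-max , λ ρ (ρ⊆A , ρ-max) _ → sym (ρ-max A ⊆-refl ρ⊆A)

    nothing-left : Void (Remove (Simplex A) ⊥ A)
    nothing-left σ (σ⊆A , kept) = kept (⊥⊆ , σ⊆A)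

  module _ {X : Complex m} {v : Fin m} where

    Link-face : ∀ {η} → v ∈ η → X η → Link X v (η - v)
    Link-face v∈η Xη = y∉p-y , subst X (sym (p-y∪⁅y⁆≡p v∈η)) Xη

    Link-maximal⇒maximal : ∀ {τ} → IsMaximal (Link X v) τ → IsMaximal X (τ ∪ ⁅ v ⁆)
    Link-maximal⇒maximal {τ} ((v∉τ , Xτ⁺) , τ-max) = Xτ⁺ , maximal
      where
      maximal : ∀ η → X η → τ ∪ ⁅ v ⁆ ⊆ η → η ≡ τ ∪ ⁅ v ⁆
      maximal η Xη τ⁺⊆η = begin
        η                ≡⟨ p-y∪⁅y⁆≡p v∈η ⟨
        (η - v) ∪ ⁅ v ⁆  ≡⟨ cong (_∪ ⁅ v ⁆) (τ-max (η - v) (Link-face v∈η Xη) τ⊆η-v) ⟩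
        τ ∪ ⁅ v ⁆        ∎
        where
        open ≡-Reasoning
        v∈η : v ∈ η
        v∈η = τ⁺⊆η y∈p∪⁅y⁆
        τ⊆η-v : τ ⊆ η - v
        τ⊆η-v = p⊆q∧y∉p⇒p⊆q-y (⊆-trans p⊆p∪⁅y⁆ τ⁺⊆η) v∉τ

    maximal⇒Link-maximal : ∀ {ρ} → v ∈ ρ → IsMaximal X ρ → IsMaximal (Link X v) (ρ - v)
    maximal⇒Link-maximal {ρ} v∈ρ (Xρ , ρ-max) = Link-face v∈ρ Xρ , maximal
      where
      maximal : ∀ η → Link X v η → ρ - v ⊆ η → η ≡ ρ - v
      maximal η (v∉η , Xη⁺) ρ-v⊆η = begin
        η                ≡⟨ p∪⁅y⁆-y≡p v∉η ⟨
        (η ∪ ⁅ v ⁆) - v  ≡⟨ cong (_- v) (ρ-max (η ∪ ⁅ v ⁆) Xη⁺ (p-y⊆q⇒p⊆q∪⁅y⁆ ρ-v⊆η)) ⟩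
        ρ - v            ∎
        where open ≡-Reasoning

    Link-free⇒free : ∀ {σ τ} → FreeIn (Link X v) σ τ → FreeIn X (σ ∪ ⁅ v ⁆) (τ ∪ ⁅ v ⁆)
    Link-free⇒free {σ} {τ} ((v∉σ , Xσ⁺) , σ⊆τ , τ-max , τ-unique) =
      Xσ⁺ , ∪⁅⁆-mono σ⊆τ , Link-maximal⇒maximal τ-max , unique
      where
      unique : ∀ ρ → IsMaximal X ρ → σ ∪ ⁅ v ⁆ ⊆ ρ → ρ ≡ τ ∪ ⁅ v ⁆
      unique ρ ρ-max σ⁺⊆ρ = begin
        ρ                ≡⟨ p-y∪⁅y⁆≡p v∈ρ ⟨
        (ρ - v) ∪ ⁅ v ⁆  ≡⟨ cong (_∪ ⁅ v ⁆) (τ-unique (ρ - v) (maximal⇒Link-maximal v∈ρ ρ-max) σ⊆ρ-v) ⟩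
        τ ∪ ⁅ v ⁆        ∎
        where
        open ≡-Reasoning
        v∈ρ : v ∈ ρ
        v∈ρ = σ⁺⊆ρ y∈p∪⁅y⁆
        σ⊆ρ-v : σ ⊆ ρ - v
        σ⊆ρ-v = p⊆q∧y∉p⇒p⊆q-y (⊆-trans p⊆p∪⁅y⁆ σ⁺⊆ρ) v∉σ

    Link-Remove : ∀ {σ τ} → v ∉ σ →
                  Link (Remove X (σ ∪ ⁅ v ⁆) (τ ∪ ⁅ v ⁆)) v ≐ Remove (Link X v) σ τ
    Link-Remove v∉σ =
      (λ (v∉η , Xη⁺ , kept) → (v∉η , Xη⁺) , λ (σ⊆η , η⊆τ) → kept (∪⁅⁆-mono σ⊆η , ∪⁅⁆-mono η⊆τ)) ,
      (λ ((v∉η , Xη⁺) , kept) → v∉η , Xη⁺ ,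
         λ (σ⁺⊆η⁺ , η⁺⊆τ⁺) → kept (∪⁅⁆-cancel v∉σ σ⁺⊆η⁺ , ∪⁅⁆-cancel v∉η η⁺⊆τ⁺))

    Del-Remove : ∀ {σ τ} → Del (Remove X (σ ∪ ⁅ v ⁆) τ) v ≐ Del X v
    Del-Remove =
      (λ (v∉η , Xη , _) → v∉η , Xη) ,
      (λ (v∉η , Xη) → v∉η , Xη , λ (σ⁺⊆η , _) → v∉η (σ⁺⊆η y∈p∪⁅y⁆))

    Del≐self : Void (Link X v) → Del X v ≐ X
    Del≐self link-void = proj₂ , λ {η} Xη → (λ v∈η → link-void (η - v) (Link-face v∈η Xη)) , Xη

  -- An elementary collapse of the link, with v added to both faces, is an elementary collapse of X;
  -- once the link is void, X is its deletion.
  Collapsible-Link-Del : ∀ {e d} {L X : Complex m} {v} →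
    Collapsible e L → L ≐ Link X v → e < d → Collapsible d (Del X v) → Collapsible d X
  Collapsible-Link-Del (done L-void) L≐ _ del =
    Collapsible-resp-≐ (Del≐self (λ η Lη → L-void η (proj₂ L≐ Lη))) del
  Collapsible-Link-Del {X = X} {v} (step σ τ free ∣σ∣≤e rest) L≐ e<d del =
    step (σ ∪ ⁅ v ⁆) (τ ∪ ⁅ v ⁆) (Link-free⇒free link-free)
         (≤-trans (∣p∪⁅y⁆∣≤1+∣p∣ σ v) (≤-trans (s≤s ∣σ∣≤e) e<d))
         (Collapsible-Link-Del rest (≐-trans (Remove-resp-≐ L≐) (≐-sym (Link-Remove {X = X} v∉σ))) e<d
            (Collapsible-resp-≐ (≐-sym Del-Remove) del))
    where
    link-free : FreeIn (Link X v) σ τ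
    link-free = FreeIn-resp-≐ L≐ free
    v∉σ : v ∉ σ
    v∉σ = proj₁ (proj₁ link-free)

-- Independence complexes and simplicial vertices

module _ {m : ℕ} (G : Graph m) where

  Adj? : ∀ u → Decidable (Adj G u)
  Adj? u w = adj G u w ≟ᵇ true

  Adj-sym : ∀ {u w} → Adj G u w → Adj G w u
  Adj-sym {u} {w} = trans (symm G w u)

  Adj-irrefl : ∀ {u} → ¬ Adj G u u
  Adj-irrefl {u} u~u = contradiction (trans (sym (irrefl G u)) u~u) λ ()

  Near : Fin m → Fin m → Set
  Near u w = u ≡ w ⊎ Adj G u w

  Near? : ∀ u → Decidable (Near u)
  Near? u w = (u ≟ᶠ w) ⊎-dec Adj? u w

  Apart : Fin m → Fin m → Set
  Apart u w = ¬ Near u w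

  neighbours : Fin m → Subset m
  neighbours v = select (Adj? v)

  farFrom : Fin m → Subset m
  farFrom v = select (λ w → ¬? (Near? v w))

  ∈neighbours⁺ : ∀ {v x} → Adj G v x → x ∈ neighbours v
  ∈neighbours⁺ {v} = ∈-select⁺ (Adj? v)

  ∈neighbours⁻ : ∀ {v x} → x ∈ neighbours v → Adj G v x
  ∈neighbours⁻ {v} = ∈-select⁻ (Adj? v)

  ∈farFrom⁺ : ∀ {v x} → Apart v x → x ∈ farFrom v
  ∈farFrom⁺ {v} = ∈-select⁺ (λ w → ¬? (Near? v w))

  ∈farFrom⁻ : ∀ {v x} → x ∈ farFrom v → Apart v x
  ∈farFrom⁻ {v} = ∈-select⁻ (λ w → ¬? (Near? v w))

  Independent : Subset m → Set
  Independent S = ∀ u w → u ∈ S → w ∈ S → ¬ Adj G u w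

  Clique : Subset m → Set
  Clique S = ∀ {u w} → u ∈ S → w ∈ S → u ≢ w → Adj G u w

  Simplicial : Subset m → Fin m → Set
  Simplicial W v = ∀ {u w} → u ∈ W → w ∈ W → Adj G v u → Adj G v w → u ≢ w → Adj G u w

  Disjoint : Subset m → Subset m → Set
  Disjoint W A = ∀ {x} → x ∈ W → x ∉ A

  -- For disjoint W and A, the join of I_n(G[W]) with the full simplex on A.
  I⋆Δ : Subset m → Subset m → ℕ → Complex m
  I⋆Δ W A n U = U ⊆ W ∪ A × αLess G (U ∩ W) n

  Independent-⊆ : ∀ {S T} → S ⊆ T → Independent T → Independent S
  Independent-⊆ S⊆T T-indep u w u∈S w∈S = T-indep u w (S⊆T u∈S) (S⊆T w∈S)

  Independent-⁅⁆ : ∀ x → Independent ⁅ x ⁆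
  Independent-⁅⁆ x u w u∈ w∈ rewrite x∈⁅y⁆⇒x≡y x u∈ | x∈⁅y⁆⇒x≡y x w∈ = Adj-irrefl

  Independent-∪⁅⁆ : ∀ {S v} → Independent S → (∀ {u} → u ∈ S → ¬ Adj G v u) → Independent (S ∪ ⁅ v ⁆)
  Independent-∪⁅⁆ {S} {v} S-indep v≁S u w u∈ w∈ with x∈p∪⁅y⁆⁻ u∈ | x∈p∪⁅y⁆⁻ w∈
  ... | inj₁ u∈S | inj₁ w∈S = S-indep u w u∈S w∈S
  ... | inj₁ u∈S | inj₂ refl = v≁S u∈S ∘ Adj-sym
  ... | inj₂ refl | inj₁ w∈S = v≁S w∈S
  ... | inj₂ refl | inj₂ refl = Adj-irrefl

  αLess-antimono : ∀ {U U′ n} → U ⊆ U′ → αLess G U′ n → αLess G U n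
  αLess-antimono U⊆U′ α S (S⊆U , S-indep) = α S (⊆-trans S⊆U U⊆U′ , S-indep)

  Empty⇒αLess : ∀ {U n} → Empty U → αLess G U (suc n)
  Empty⇒αLess U-empty S (S⊆U , _) =
    s≤s (≤-trans (≤-reflexive (Empty⇒∣p∣≡0 (λ (x , x∈S) → U-empty (x , S⊆U x∈S)))) z≤n)

  αLess-1⇒Empty : ∀ {U} → αLess G U 1 → Empty U
  αLess-1⇒Empty α (x , x∈U) = <-irrefl (∣⁅x⁆∣≡1 x) (α ⁅ x ⁆ (⁅x⁆⊆U , Independent-⁅⁆ x))
    where
    ⁅x⁆⊆U : ⁅ x ⁆ ⊆ _
    ⁅x⁆⊆U y∈ rewrite x∈⁅y⁆⇒x≡y x y∈ = x∈U

  Simplicial⇒Near-clique : ∀ {W v x y} → Simplicial W v → x ∈ W → y ∈ W →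
                           Near v x → Near v y → x ≢ y → Adj G x y
  Simplicial⇒Near-clique _ _ _ (inj₁ refl) (inj₁ refl) x≢y = contradiction refl x≢y
  Simplicial⇒Near-clique _ _ _ (inj₁ refl) (inj₂ v~y) _ = v~y
  Simplicial⇒Near-clique _ _ _ (inj₂ v~x) (inj₁ refl) _ = Adj-sym v~x
  Simplicial⇒Near-clique v-simp x∈W y∈W (inj₂ v~x) (inj₂ v~y) x≢y = v-simp x∈W y∈W v~x v~y x≢y

  ⊆W∪A⇒⊆A : ∀ {U W A : Subset m} → U ⊆ W ∪ A → Empty (U ∩ W) → U ⊆ A
  ⊆W∪A⇒⊆A {U} {W} {A} U⊆W∪A U∩W-empty {x} x∈U with x∈p∪q⁻ W A (U⊆W∪A x∈U)
  ... | inj₁ x∈W = contradiction (x , x∈p∩q⁺ (x∈U , x∈W)) U∩W-empty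
  ... | inj₂ x∈A = x∈A

  I⋆Δ-1≐Simplex : ∀ {W A} → Disjoint W A → I⋆Δ W A 1 ≐ Simplex A
  I⋆Δ-1≐Simplex {W} {A} W#A =
    (λ (U⊆W∪A , α) → ⊆W∪A⇒⊆A U⊆W∪A (αLess-1⇒Empty α)) ,
    (λ U⊆A → ⊆-trans U⊆A (q⊆p∪q W A) , Empty⇒αLess (U∩W-empty U⊆A))
    where
    U∩W-empty : ∀ {U} → U ⊆ A → Empty (U ∩ W)
    U∩W-empty {U} U⊆A (x , x∈U∩W) = W#A (proj₂ (x∈p∩q⁻ U W x∈U∩W)) (U⊆A (proj₁ (x∈p∩q⁻ U W x∈U∩W)))

  I⋆Δ-Empty≐Simplex : ∀ {W A n} → Empty W → I⋆Δ W A (suc n) ≐ Simplex A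
  I⋆Δ-Empty≐Simplex {W} {A} W-empty =
    (λ (U⊆W∪A , _) → ⊆W∪A⇒⊆A U⊆W∪A U∩W-empty) ,
    (λ U⊆A → ⊆-trans U⊆A (q⊆p∪q W A) , Empty⇒αLess U∩W-empty)
    where
    U∩W-empty : ∀ {U} → Empty (U ∩ W)
    U∩W-empty {U} (x , x∈U∩W) = W-empty (x , proj₂ (x∈p∩q⁻ U W x∈U∩W))

  I≐I⋆Δ : ∀ {n} → I n G ≐ I⋆Δ ⊤ ⊥ n
  I≐I⋆Δ = (λ α → (λ _ → x∈p∪q⁺ (inj₁ ∈⊤)) , αLess-antimono (p∩q⊆p _ ⊤) α) ,
          (λ (_ , α) → αLess-antimono (λ x∈U → x∈p∩q⁺ (x∈U , ∈⊤)) α)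

  module _ {W A : Subset m} {v : Fin m} (v∈W : v ∈ W) (W#A : Disjoint W A) where

    Del-I⋆Δ : ∀ {n} → Del (I⋆Δ W A n) v ≐ I⋆Δ (W - v) A n
    Del-I⋆Δ =
      (λ (v∉η , η⊆W∪A , α) → cover-del v∉η η⊆W∪A , αLess-antimono (∩-mono id p-y⊆p) α) ,
      (λ (η⊆ , α) → v∉η η⊆ , ⊆-trans η⊆ (∪-mono p-y⊆p id) ,
                      αLess-antimono (p∩q⊆p∩q-y (v∉η η⊆)) α)
      where
      cover-del : ∀ {η} → v ∉ η → η ⊆ W ∪ A → η ⊆ (W - v) ∪ A
      cover-del v∉η η⊆W∪A {x} x∈η =
        x∈p∪q⁺ (Sum.map₁ (λ x∈W → x∈p∧x≢y⇒x∈p-y x∈W λ { refl → v∉η x∈η }) (x∈p∪q⁻ W A (η⊆W∪A x∈η)))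
      v∉η : ∀ {η} → η ⊆ (W - v) ∪ A → v ∉ η
      v∉η η⊆ v∈η = [ y∉p-y , W#A v∈W ]′ (x∈p∪q⁻ (W - v) A (η⊆ v∈η))

    W∩farFrom⊂W : W ∩ farFrom v ⊂ W
    W∩farFrom⊂W = p∩q⊆p W _ , v , v∈W , (λ v∈ → ∈farFrom⁻ v∈ (inj₁ refl)) ∘ p∩q⊆q W _

    Disjoint-link : Disjoint (W ∩ farFrom v) (A ∪ (W ∩ neighbours v))
    Disjoint-link x∈W∩F x∈A⁺ with x∈p∩q⁻ W _ x∈W∩F | x∈p∪q⁻ A _ x∈A⁺
    ... | x∈W , _   | inj₁ x∈A = W#A x∈W x∈A
    ... | _   , v#x | inj₂ x∈N = ∈farFrom⁻ v#x (inj₂ (∈neighbours⁻ (p∩q⊆q W _ x∈N)))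

    module _ (v-simplicial : Simplicial W v) {k : ℕ} where

      private
        F : Subset m
        F = W ∩ farFrom v
        A⁺ : Subset m
        A⁺ = A ∪ (W ∩ neighbours v)

      cover-link⇒ : ∀ {η} → v ∉ η → η ∪ ⁅ v ⁆ ⊆ W ∪ A → η ⊆ F ∪ A⁺
      cover-link⇒ v∉η η⁺⊆W∪A {x} x∈η with x∈p∪q⁻ W A (η⁺⊆W∪A (p⊆p∪⁅y⁆ x∈η)) | Near? v x
      ... | inj₂ x∈A | _               = x∈p∪q⁺ (inj₂ (x∈p∪q⁺ (inj₁ x∈A)))
      ... | inj₁ _   | yes (inj₁ refl) = contradiction x∈η v∉η
      ... | inj₁ x∈W | yes (inj₂ v~x)  = x∈p∪q⁺ (inj₂ (q⊆p∪q A _ (x∈p∩q⁺ (x∈W , ∈neighbours⁺ v~x))))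
      ... | inj₁ x∈W | no v#x          = x∈p∪q⁺ (inj₁ (x∈p∩q⁺ (x∈W , ∈farFrom⁺ v#x)))

      cover-link⇐ : ∀ {η} → η ⊆ F ∪ A⁺ → η ∪ ⁅ v ⁆ ⊆ W ∪ A
      cover-link⇐ η⊆ = p⊆q∧y∈q⇒p∪⁅y⁆⊆q
        (⊆-trans η⊆ (λ x∈ → [ p⊆p∪q A ∘ p∩q⊆p W _ , [ q⊆p∪q W A , p⊆p∪q A ∘ p∩q⊆p W _ ]′ ∘ x∈p∪q⁻ A _ ]′
                              (x∈p∪q⁻ F A⁺ x∈)))
        (p⊆p∪q A v∈W)

      v∉cover-link : ∀ {η} → η ⊆ F ∪ A⁺ → v ∉ η
      v∉cover-link η⊆ v∈η with x∈p∪q⁻ F A⁺ (η⊆ v∈η)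
      ... | inj₁ v∈F = ∈farFrom⁻ (p∩q⊆q W _ v∈F) (inj₁ refl)
      ... | inj₂ v∈A⁺ = [ W#A v∈W , Adj-irrefl ∘ ∈neighbours⁻ ∘ p∩q⊆q W _ ]′ (x∈p∪q⁻ A _ v∈A⁺)

      αLess-link⇒ : ∀ {η} → αLess G ((η ∪ ⁅ v ⁆) ∩ W) (suc (suc k)) → αLess G (η ∩ F) (suc k)
      αLess-link⇒ {η} α S (S⊆η∩F , S-indep) =
        ≤-pred (≤-trans (s≤s ∣S∣<∣S⁺∣) (α (S ∪ ⁅ v ⁆) (S⁺⊆ , S⁺-indep)))
        where
        S⊆F : S ⊆ F
        S⊆F = p∩q⊆q η F ∘ S⊆η∩F
        Apart-v : ∀ {u} → u ∈ S → Apart v u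
        Apart-v = ∈farFrom⁻ ∘ p∩q⊆q W _ ∘ S⊆F
        S⁺⊆ : S ∪ ⁅ v ⁆ ⊆ (η ∪ ⁅ v ⁆) ∩ W
        S⁺⊆ = p⊆q∧y∈q⇒p∪⁅y⁆⊆q (∩-mono p⊆p∪⁅y⁆ (p∩q⊆p W _) ∘ S⊆η∩F) (x∈p∩q⁺ (y∈p∪⁅y⁆ , v∈W))
        S⁺-indep : Independent (S ∪ ⁅ v ⁆)
        S⁺-indep = Independent-∪⁅⁆ S-indep (λ u∈S → Apart-v u∈S ∘ inj₂)
        ∣S∣<∣S⁺∣ : ∣ S ∣ < ∣ S ∪ ⁅ v ⁆ ∣
        ∣S∣<∣S⁺∣ = p⊂q⇒∣p∣<∣q∣ (p⊆p∪⁅y⁆ , v , y∈p∪⁅y⁆ , λ v∈S → Apart-v v∈S (inj₁ refl))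

      -- The vertices of S outside F are v and neighbours of v, which form a clique; so at most one.
      αLess-link⇐ : ∀ {η} → αLess G (η ∩ F) (suc k) → αLess G ((η ∪ ⁅ v ⁆) ∩ W) (suc (suc k))
      αLess-link⇐ {η} α S (S⊆ , S-indep) = s≤s (begin
        ∣ S ∣                  ≤⟨ ∣p∣≤∣p∩q∣+∣p─q∣ S F ⟩
        ∣ S ∩ F ∣ + ∣ S ─ F ∣  ≤⟨ +-mono-≤ (≤-pred ∣S∩F∣<1+k) ∣S─F∣≤1 ⟩
        k + 1                  ≡⟨ +-comm k 1 ⟩
        suc k                  ∎)
        where
        open ≤-Reasoning
        S⊆W : S ⊆ W
        S⊆W = p∩q⊆q _ W ∘ S⊆
        S∩F⊆η : S ∩ F ⊆ η
        S∩F⊆η x∈ with x∈p∩q⁻ S F x∈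
        ... | x∈S , x∈F = x∈p∪⁅y⁆∧x≢y⇒x∈p (p∩q⊆p _ W (S⊆ x∈S))
                            λ { refl → ∈farFrom⁻ (p∩q⊆q W _ x∈F) (inj₁ refl) }
        ∣S∩F∣<1+k : ∣ S ∩ F ∣ < suc k
        ∣S∩F∣<1+k = α (S ∩ F) ((λ x∈ → x∈p∩q⁺ (S∩F⊆η x∈ , p∩q⊆q S F x∈)) ,
                               Independent-⊆ (p∩q⊆p S F) S-indep)
        outside-F : ∀ {x} → x ∈ S ─ F → x ∈ S × x ∈ W × Near v x
        outside-F {x} x∈ = x∈S , S⊆W x∈S , decidable-stable (Near? v x) λ v#x →
          x∈p─q⇒x∉q S F x∈ (x∈p∩q⁺ (S⊆W x∈S , ∈farFrom⁺ v#x))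
          where
          x∈S : x ∈ S
          x∈S = p─q⊆p S F x∈
        S─F-subsingleton : ∀ {x y} → x ∈ S ─ F → y ∈ S ─ F → x ≡ y
        S─F-subsingleton {x} {y} x∈ y∈ with outside-F x∈ | outside-F y∈
        ... | x∈S , x∈W , v≈x | y∈S , y∈W , v≈y = decidable-stable (x ≟ᶠ y) λ x≢y →
          S-indep x y x∈S y∈S (Simplicial⇒Near-clique v-simplicial x∈W y∈W v≈x v≈y x≢y)
        ∣S─F∣≤1 : ∣ S ─ F ∣ ≤ 1
        ∣S─F∣≤1 = ∣p∣≤1 S─F-subsingleton

      Link-I⋆Δ : Link (I⋆Δ W A (suc (suc k))) v ≐ I⋆Δ (W ∩ farFrom v) (A ∪ (W ∩ neighbours v)) (suc k)
      Link-I⋆Δ =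
        (λ (v∉η , η⁺⊆ , α) → cover-link⇒ v∉η η⁺⊆ , αLess-link⇒ α) ,
        (λ (η⊆ , α) → v∉cover-link η⊆ , cover-link⇐ η⊆ , αLess-link⇐ α)

  HasSimplicialVertices : Set
  HasSimplicialVertices = ∀ {W} → Nonempty W → ∃[ v ] v ∈ W × Simplicial W v

  module _ (simplicial : HasSimplicialVertices) where

    Collapsible-I⋆Δ : ∀ {W A} n → Acc _⊂_ W → Disjoint W A → Collapsible n (I⋆Δ W A (suc n))
    Collapsible-I⋆Δ zero _ W#A = Collapsible-resp-≐ (≐-sym (I⋆Δ-1≐Simplex W#A)) (Collapsible-Simplex _)
    Collapsible-I⋆Δ {W} {A} (suc n) (acc smaller) W#A with nonempty? W
    ... | no W-empty = Collapsible-resp-≐ (≐-sym (I⋆Δ-Empty≐Simplex W-empty)) (Collapsible-Simplex A)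
    ... | yes W-nonempty with simplicial W-nonempty
    ... | v , v∈W , v-simplicial =
      Collapsible-Link-Del
        (Collapsible-I⋆Δ n (smaller (W∩farFrom⊂W v∈W W#A)) (Disjoint-link v∈W W#A))
        (≐-sym (Link-I⋆Δ v∈W W#A v-simplicial))
        ≤-refl
        (Collapsible-resp-≐ (≐-sym (Del-I⋆Δ v∈W W#A))
          (Collapsible-I⋆Δ (suc n) (smaller (x∈p⇒p-x⊂p v∈W)) (W#A ∘ p-y⊆p)))

    Collapsible-I : ∀ n → Collapsible n (I (suc n) G)
    Collapsible-I n = Collapsible-resp-≐ (≐-sym I≐I⋆Δ) (Collapsible-I⋆Δ n (⊂-wellFounded ⊤) (λ _ → ∉⊥))

  -- Walks, induced paths and induced cycles

  data Walk : Fin m → Fin m → List (Fin m) → Set where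
    []  : ∀ {a} → Walk a a []
    _∷_ : ∀ {a b c ps} → Adj G a c → Walk c b ps → Walk a b (c ∷ ps)

  _++ʷ_ : ∀ {a b c ps qs} → Walk a b ps → Walk b c qs → Walk a c (ps ++ qs)
  []           ++ʷ walk = walk
  (a~c ∷ rest) ++ʷ walk = a~c ∷ (rest ++ʷ walk)

  data InducedPath : Fin m → Fin m → List (Fin m) → Set where
    []   : ∀ {a} → InducedPath a a []
    cons : ∀ {a b c ps} → Adj G a c → All (Apart a) ps → InducedPath c b ps → InducedPath a b (c ∷ ps)

  -- Prepend a, cutting the path at the last of its vertices near a.
  prepend : ∀ {P : Fin m → Set} {a b c qs} → InducedPath c b qs → All P (c ∷ qs) →
            Any (Near a) (c ∷ qs) → ∃[ rs ] InducedPath a b rs × All P rs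
  prepend {a = a} {qs = qs} path (pc ∷ pqs) near with anyˡ? (Near? a) qs
  prepend (cons _ _ rest) (_ ∷ pqs) _ | yes later = prepend rest pqs later
  prepend {c = c} {qs} path (pc ∷ pqs) near | no none with near
  ... | there later      = contradiction later none
  ... | here (inj₁ refl) = qs , path , pqs
  ... | here (inj₂ a~c)  = c ∷ qs , cons a~c (¬Any⇒All¬ qs none) path , pc ∷ pqs

  Walk⇒InducedPath : ∀ {P : Fin m → Set} {a b ps} → Walk a b ps → All P ps →
                     ∃[ qs ] InducedPath a b qs × All P qs
  Walk⇒InducedPath [] [] = [] , [] , []
  Walk⇒InducedPath (a~c ∷ walk) (pc ∷ pps) with Walk⇒InducedPath walk pps
  ... | qs , path , pqs = prepend path (pc ∷ pqs) (here (inj₂ a~c))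

  Consecutive : ∀ {k} → Fin k → Fin k → Set
  Consecutive i j = toℕ j ≡ suc (toℕ i) ⊎ toℕ i ≡ suc (toℕ j)

  apart-lookup : ∀ {a ps} → All (Apart a) ps → ∀ j → Apart a (lookup ps j)
  apart-lookup as j = lookupᴬ as (∈-lookup j)

  lookup-injective : ∀ {a b qs} → InducedPath a b qs →
                     ∀ i j → lookup (a ∷ qs) i ≡ lookup (a ∷ qs) j → i ≡ j
  lookup-injective _ zero zero _ = refl
  lookup-injective (cons a~c _ _) zero (suc zero) refl = contradiction a~c Adj-irrefl
  lookup-injective (cons _ as _) zero (suc (suc j)) a≡ = contradiction (inj₁ a≡) (apart-lookup as j)
  lookup-injective (cons a~c _ _) (suc zero) zero refl = contradiction a~c Adj-irrefl
  lookup-injective (cons _ as _) (suc (suc i)) zero ≡a =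
    contradiction (inj₁ (sym ≡a)) (apart-lookup as i)
  lookup-injective (cons _ _ rest) (suc i) (suc j) eq = cong suc (lookup-injective rest i j eq)

  lookup-Adj⇒Consecutive : ∀ {a b qs} → InducedPath a b qs →
                     ∀ i j → Adj G (lookup (a ∷ qs) i) (lookup (a ∷ qs) j) → Consecutive i j
  lookup-Adj⇒Consecutive [] zero zero a~a = contradiction a~a Adj-irrefl
  lookup-Adj⇒Consecutive (cons _ _ _) zero zero a~a = contradiction a~a Adj-irrefl
  lookup-Adj⇒Consecutive (cons _ _ _) zero (suc zero) _ = inj₁ refl
  lookup-Adj⇒Consecutive (cons _ as _) zero (suc (suc j)) a~ =
    contradiction (inj₂ a~) (apart-lookup as j)
  lookup-Adj⇒Consecutive (cons _ _ _) (suc zero) zero _ = inj₂ refl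
  lookup-Adj⇒Consecutive (cons _ as _) (suc (suc i)) zero ~a =
    contradiction (inj₂ (Adj-sym ~a)) (apart-lookup as i)
  lookup-Adj⇒Consecutive (cons _ _ rest) (suc i) (suc j) adj =
    Sum.map (cong suc) (cong suc) (lookup-Adj⇒Consecutive rest i j adj)

  Consecutive⇒lookup-Adj : ∀ {a b qs} → InducedPath a b qs →
                     ∀ i j → Consecutive i j → Adj G (lookup (a ∷ qs) i) (lookup (a ∷ qs) j)
  Consecutive⇒lookup-Adj (cons a~c _ _) zero (suc zero) _ = a~c
  Consecutive⇒lookup-Adj (cons a~c _ _) (suc zero) zero _ = Adj-sym a~c
  Consecutive⇒lookup-Adj (cons _ _ rest) (suc i) (suc j) cons-ij =
    Consecutive⇒lookup-Adj rest i j (Sum.map suc-injective suc-injective cons-ij)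
  Consecutive⇒lookup-Adj []             zero zero          (inj₁ ())
  Consecutive⇒lookup-Adj []             zero zero          (inj₂ ())
  Consecutive⇒lookup-Adj (cons _ _ _)   zero zero          (inj₁ ())
  Consecutive⇒lookup-Adj (cons _ _ _)   zero zero          (inj₂ ())
  Consecutive⇒lookup-Adj (cons _ _ _)   zero (suc (suc _)) (inj₁ ())
  Consecutive⇒lookup-Adj (cons _ _ _)   zero (suc (suc _)) (inj₂ ())
  Consecutive⇒lookup-Adj (cons _ _ _)   (suc (suc _)) zero (inj₁ ())
  Consecutive⇒lookup-Adj (cons _ _ _)   (suc (suc _)) zero (inj₂ ())

  lookup-last : ∀ {a b qs} → InducedPath a b qs → lookup (a ∷ qs) (fromℕ (length qs)) ≡ b
  lookup-last []            = refl
  lookup-last (cons _ _ rest) = lookup-last rest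

  length≥2 : ∀ {a b qs} → InducedPath a b qs → Apart a b → 2 ≤ length qs
  length≥2 []                              a#b = contradiction (inj₁ refl) a#b
  length≥2 (cons a~b _ [])                 a#b = contradiction (inj₂ a~b) a#b
  length≥2 (cons _ _ (cons _ _ _))         _   = s≤s (s≤s z≤n)

  apexCycle : Fin m → (L : List (Fin m)) → Fin (suc (length L)) → Fin m
  apexCycle x L zero    = x
  apexCycle x L (suc i) = lookup L i

  IsInducedCycle-apex : ∀ {x s₁ s₂ qs} → InducedPath s₁ s₂ qs → Adj G x s₁ → Adj G x s₂ →
    (∀ j → x ≢ lookup (s₁ ∷ qs) j) →
    (∀ j → Adj G x (lookup (s₁ ∷ qs) j) → toℕ j ≡ 0 ⊎ toℕ j ≡ length qs) →
    IsInducedCycle G (suc (suc (length qs))) (apexCycle x (s₁ ∷ qs))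
  IsInducedCycle-apex {x} {s₁} {s₂} {qs} path x~s₁ x~s₂ x≢ x~⇒end = injective , adjacency
    where
    L : List (Fin m)
    L = s₁ ∷ qs
    k : ℕ
    k = suc (suc (length qs))

    end⇒x~ : ∀ j → toℕ j ≡ 0 ⊎ toℕ j ≡ length qs → Adj G x (lookup L j)
    end⇒x~ zero    _         = x~s₁
    end⇒x~ (suc j) (inj₁ ())
    end⇒x~ j       (inj₂ j≡) =
      subst (Adj G x) (sym (trans (cong (lookup L) j≡last) (lookup-last path))) x~s₂
      where
      j≡last : j ≡ fromℕ (length qs)
      j≡last = toℕ-injective (trans j≡ (sym (toℕ-fromℕ _)))

    injective : ∀ i j → apexCycle x L i ≡ apexCycle x L j → i ≡ j
    injective zero    zero    _  = refl
    injective zero    (suc j) x≡ = contradiction x≡ (x≢ j)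
    injective (suc i) zero    ≡x = contradiction (sym ≡x) (x≢ i)
    injective (suc i) (suc j) eq = cong suc (lookup-injective path i j eq)

    adjacency : ∀ i j → (Adj G (apexCycle x L i) (apexCycle x L j) → CycNbr k i j) ×
                        (CycNbr k i j → Adj G (apexCycle x L i) (apexCycle x L j))
    adjacency zero zero = (λ x~x → contradiction x~x Adj-irrefl) ,
      λ { (inj₁ ()) ; (inj₂ (inj₁ ())) ; (inj₂ (inj₂ (inj₁ (_ , ())))) ; (inj₂ (inj₂ (inj₂ (_ , ())))) }
    adjacency zero (suc j) =
      (λ x~ → [ (λ j≡0 → inj₁ (cong suc j≡0)) , (λ j≡ → inj₂ (inj₂ (inj₁ (refl , cong suc j≡)))) ]′
                (x~⇒end j x~)) ,
      λ { (inj₁ j≡)                    → end⇒x~ j (inj₁ (suc-injective j≡))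
        ; (inj₂ (inj₁ ()))
        ; (inj₂ (inj₂ (inj₁ (_ , j≡)))) → end⇒x~ j (inj₂ (suc-injective j≡))
        ; (inj₂ (inj₂ (inj₂ (() , _)))) }
    adjacency (suc i) zero =
      (λ ~x → [ (λ i≡0 → inj₂ (inj₁ (cong suc i≡0))) ,
                (λ i≡ → inj₂ (inj₂ (inj₂ (refl , cong suc i≡)))) ]′
                (x~⇒end i (Adj-sym ~x))) ,
      λ { (inj₁ ())
        ; (inj₂ (inj₁ i≡))              → Adj-sym (end⇒x~ i (inj₁ (suc-injective i≡)))
        ; (inj₂ (inj₂ (inj₁ (() , _))))
        ; (inj₂ (inj₂ (inj₂ (_ , i≡)))) → Adj-sym (end⇒x~ i (inj₂ (suc-injective i≡))) }
    adjacency (suc i) (suc j) =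
      (λ adj → Sum.map (cong suc) (inj₁ ∘ cong suc) (lookup-Adj⇒Consecutive path i j adj)) ,
      λ { (inj₁ j≡)                    → Consecutive⇒lookup-Adj path i j (inj₁ (suc-injective j≡))
        ; (inj₂ (inj₁ i≡))              → Consecutive⇒lookup-Adj path i j (inj₂ (suc-injective i≡))
        ; (inj₂ (inj₂ (inj₁ (() , _))))
        ; (inj₂ (inj₂ (inj₂ (() , _)))) }

  -- x followed by the path would be an induced cycle of length at least 4.
  Chordal⇒no-apex-over-InducedPath : Chordal G → ∀ {x s₁ s₂ qs} → InducedPath s₁ s₂ qs → Apart s₁ s₂ →
    Adj G x s₁ → Adj G x s₂ → ¬ All (λ z → Apart x z ⊎ z ≡ s₂) qs
  Chordal⇒no-apex-over-InducedPath chordal {x} {s₁} {s₂} {qs} path s₁#s₂ x~s₁ x~s₂ inner =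
    chordal _ (s≤s (s≤s (length≥2 path s₁#s₂))) (apexCycle x (s₁ ∷ qs))
      (IsInducedCycle-apex path x~s₁ x~s₂ x≢ x~⇒end)
    where
    x≢ : ∀ j → x ≢ lookup (s₁ ∷ qs) j
    x≢ zero    refl = Adj-irrefl x~s₁
    x≢ (suc j) x≡ with lookupᴬ inner (∈-lookup j)
    ... | inj₁ x#z  = x#z (inj₁ x≡)
    ... | inj₂ z≡s₂ = Adj-irrefl (subst (Adj G x) (sym (trans x≡ z≡s₂)) x~s₂)

    x~⇒end : ∀ j → Adj G x (lookup (s₁ ∷ qs) j) → toℕ j ≡ 0 ⊎ toℕ j ≡ length qs
    x~⇒end zero    _  = inj₁ refl
    x~⇒end (suc j) x~ with lookupᴬ inner (∈-lookup j)
    ... | inj₁ x#z  = contradiction (inj₂ x~) x#z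
    ... | inj₂ z≡s₂ = inj₂ (trans (cong toℕ (lookup-injective path (suc j) (fromℕ _)
                                    (trans z≡s₂ (sym (lookup-last path))))) (toℕ-fromℕ _))

  Chordal⇒detour-Near : Chordal G → ∀ {x s₁ s₂ ps} → Adj G x s₁ → Adj G x s₂ → Walk s₁ s₂ ps →
                        All (λ z → Apart x z ⊎ z ≡ s₂) ps → Near s₁ s₂
  Chordal⇒detour-Near chordal x~s₁ x~s₂ walk inner = decidable-stable (Near? _ _) λ s₁#s₂ →
    let (qs , path , inner′) = Walk⇒InducedPath walk inner
    in Chordal⇒no-apex-over-InducedPath chordal path s₁#s₂ x~s₁ x~s₂ inner′

  -- Components and Dirac's lemma

  WalkIn : Subset m → Fin m → Fin m → Set
  WalkIn D a b = ∃[ ps ] Walk a b ps × All (_∈ D) ps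

  module _ {D : Subset m} where

    WalkIn-++ : ∀ {a b c} → WalkIn D a b → WalkIn D b c → WalkIn D a c
    WalkIn-++ (ps , walk , ps∈D) (qs , walk′ , qs∈D) = ps ++ qs , walk ++ʷ walk′ , ++⁺ ps∈D qs∈D

    WalkIn-step : ∀ {a b} → Adj G a b → b ∈ D → WalkIn D a b
    WalkIn-step a~b b∈D = _ , a~b ∷ [] , b∈D ∷ []

    WalkIn-reverse : ∀ {a b} → a ∈ D → WalkIn D a b → WalkIn D b a
    WalkIn-reverse a∈D (_ , walk , ps∈D) = reverse walk ps∈D a∈D
      where
      reverse : ∀ {a b ps} → Walk a b ps → All (_∈ D) ps → a ∈ D → WalkIn D b a
      reverse []           []           _   = _ , [] , []
      reverse (a~c ∷ walk) (c∈D ∷ ps∈D) a∈D =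
        WalkIn-++ (reverse walk ps∈D c∈D) (WalkIn-step (Adj-sym a~c) a∈D)

  record Component (D : Subset m) (c₀ : Fin m) : Set where
    field
      C      : Subset m
      C⊆D    : C ⊆ D
      c₀∈C   : c₀ ∈ C
      reach  : ∀ {c} → c ∈ C → WalkIn D c₀ c
      closed : ∀ {c z} → c ∈ C → z ∈ D → Adj G c z → z ∈ C

  component : ∀ {D c₀} → c₀ ∈ D → Component D c₀
  component {D} {c₀} c₀∈D = grow ⁅ c₀ ⁆ (⊃-wellFounded _) ⁅c₀⁆⊆D (x∈⁅x⁆ c₀) reach₀
    where
    ⁅c₀⁆⊆D : ⁅ c₀ ⁆ ⊆ D
    ⁅c₀⁆⊆D c∈ rewrite x∈⁅y⁆⇒x≡y c₀ c∈ = c₀∈D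

    reach₀ : ∀ {c} → c ∈ ⁅ c₀ ⁆ → WalkIn D c₀ c
    reach₀ c∈ rewrite x∈⁅y⁆⇒x≡y c₀ c∈ = _ , [] , []

    grow : ∀ C → Acc _⊃_ C → C ⊆ D → c₀ ∈ C → (∀ {c} → c ∈ C → WalkIn D c₀ c) → Component D c₀
    grow C (acc larger) C⊆D c₀∈C reach
      with any? (λ c → any? (λ z → (c ∈? C) ×-dec (z ∈? D) ×-dec ¬? (z ∈? C) ×-dec Adj? c z))
    ... | yes (c , z , c∈C , z∈D , z∉C , c~z) =
      grow (C ∪ ⁅ z ⁆) (larger (p⊆p∪⁅y⁆ , z , y∈p∪⁅y⁆ , z∉C))
           (p⊆q∧y∈q⇒p∪⁅y⁆⊆q C⊆D z∈D) (p⊆p∪⁅y⁆ c₀∈C) reach⁺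
      where
      reach⁺ : ∀ {c′} → c′ ∈ C ∪ ⁅ z ⁆ → WalkIn D c₀ c′
      reach⁺ c′∈ with x∈p∪⁅y⁆⁻ c′∈
      ... | inj₁ c′∈C = reach c′∈C
      ... | inj₂ refl = WalkIn-++ (reach c∈C) (WalkIn-step c~z z∈D)
    ... | no no-exit = record { C = C ; C⊆D = C⊆D ; c₀∈C = c₀∈C ; reach = reach ; closed = closed }
      where
      closed : ∀ {c z} → c ∈ C → z ∈ D → Adj G c z → z ∈ C
      closed {c} {z} c∈C z∈D c~z =
        decidable-stable (z ∈? C) λ z∉C → no-exit (c , z , c∈C , z∈D , z∉C , c~z)

  Simplicial-⊆ : ∀ {H H′ y} → (∀ {u} → u ∈ H → Adj G y u → u ∈ H′) → Simplicial H′ y → Simplicial H y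
  Simplicial-⊆ nbrs⊆ y-simp u∈H w∈H y~u y~w = y-simp (nbrs⊆ u∈H y~u) (nbrs⊆ w∈H y~w) y~u y~w

  Simplicial-∪ : ∀ {C S y} → Simplicial C y → Clique S → (∀ {s c} → s ∈ S → c ∈ C → Adj G s c) →
                 Simplicial (C ∪ S) y
  Simplicial-∪ {C} {S} y-simp S-clique S~C u∈ w∈ y~u y~w u≢w with x∈p∪q⁻ C S u∈ | x∈p∪q⁻ C S w∈
  ... | inj₁ u∈C | inj₁ w∈C = y-simp u∈C w∈C y~u y~w u≢w
  ... | inj₁ u∈C | inj₂ w∈S = Adj-sym (S~C w∈S u∈C)
  ... | inj₂ u∈S | inj₁ w∈C = S~C u∈S w∈C
  ... | inj₂ u∈S | inj₂ w∈S = S-clique u∈S w∈S u≢w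

  module _ (chordal : Chordal G) where

    module Separation {H : Subset m} {x c₀ : Fin m} (x∈H : x ∈ H) (c₀∈H : c₀ ∈ H) (x#c₀ : Apart x c₀)
      where

      D : Subset m
      D = H ∩ farFrom x

      D-apart : ∀ {z} → z ∈ D → Apart x z
      D-apart = ∈farFrom⁻ ∘ p∩q⊆q H _

      open Component (component {D} (x∈p∩q⁺ (c₀∈H , ∈farFrom⁺ x#c₀))) public

      S? : ∀ s → Dec (s ∈ H × Adj G x s × ∃[ c ] c ∈ C × Adj G s c)
      S? s = (s ∈? H) ×-dec Adj? x s ×-dec any? (λ c → (c ∈? C) ×-dec Adj? s c)

      S : Subset m
      S = select S?

      C⊆H : C ⊆ H
      C⊆H = p∩q⊆p H _ ∘ C⊆D

      x∉C : x ∉ C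
      x∉C x∈C = D-apart (C⊆D x∈C) (inj₁ refl)

      C⊂H : C ⊂ H
      C⊂H = C⊆H , x , x∈H , x∉C

      C∪S⊂H : C ∪ S ⊂ H
      C∪S⊂H = (λ y∈ → [ C⊆H , proj₁ ∘ ∈-select⁻ S? ]′ (x∈p∪q⁻ C S y∈)) , x , x∈H ,
              λ x∈ → [ x∉C , Adj-irrefl ∘ proj₁ ∘ proj₂ ∘ ∈-select⁻ S? ]′ (x∈p∪q⁻ C S x∈)

      S≢C : ∀ {s c} → s ∈ S → c ∈ C → s ≢ c
      S≢C s∈S c∈C refl = D-apart (C⊆D c∈C) (inj₂ (proj₁ (proj₂ (∈-select⁻ S? s∈S))))

      C-neighbours : ∀ {y u} → y ∈ C → u ∈ H → Adj G y u → u ∈ C ∪ S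
      C-neighbours {y} {u} y∈C u∈H y~u with Near? x u
      ... | yes (inj₁ refl) = contradiction (inj₂ (Adj-sym y~u)) (D-apart (C⊆D y∈C))
      ... | yes (inj₂ x~u)  = x∈p∪q⁺ (inj₂ (∈-select⁺ S? (u∈H , x~u , y , y∈C , Adj-sym y~u)))
      ... | no x#u          = x∈p∪q⁺ (inj₁ (closed y∈C (x∈p∩q⁺ (u∈H , ∈farFrom⁺ x#u)) y~u))

      -- The detour s₁ c₁ ⇝ c₀ ⇝ c₂ s₂ runs through D, so its inner vertices are apart from x.
      S-clique : Clique S
      S-clique {s₁} {s₂} s₁∈S s₂∈S s₁≢s₂ with ∈-select⁻ S? s₁∈S | ∈-select⁻ S? s₂∈S
      ... | _ , x~s₁ , c₁ , c₁∈C , s₁~c₁ | _ , x~s₂ , c₂ , c₂∈C , s₂~c₂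
          with WalkIn-++ (WalkIn-reverse (C⊆D c₀∈C) (reach c₁∈C)) (reach c₂∈C)
      ...   | _ , walk , ps∈D =
        [ (λ s₁≡s₂ → contradiction s₁≡s₂ s₁≢s₂) , id ]′
          (Chordal⇒detour-Near chordal x~s₁ x~s₂
            (s₁~c₁ ∷ (walk ++ʷ (Adj-sym s₂~c₂ ∷ [])))
            (inj₁ (D-apart (C⊆D c₁∈C)) ∷ ++⁺ (mapᴬ (inj₁ ∘ D-apart) ps∈D) (inj₂ refl ∷ [])))

      Apart-S⇒∈C : ∀ {s y} → s ∈ S → y ∈ C ∪ S → Apart s y → y ∈ C
      Apart-S⇒∈C s∈S y∈ s#y with x∈p∪q⁻ C S y∈
      ... | inj₁ y∈C = y∈C
      ... | inj₂ y∈S = contradiction (inj₂ (S-clique s∈S y∈S (s#y ∘ inj₁))) s#y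

      Simplicial-C : ∀ {y} → y ∈ C → Simplicial (C ∪ S) y → Simplicial H y
      Simplicial-C y∈C = Simplicial-⊆ (C-neighbours y∈C)

    -- Dirac's lemma. The vertex apart from x is found in C, recursing into C ∪ S if some vertex of S
    -- is not adjacent to some vertex of C, and into C otherwise.
    mutual
      simplicial-vertex : ∀ {H} → Acc _⊂_ H → Nonempty H → ∃[ y ] y ∈ H × Simplicial H y
      simplicial-vertex {H} rec (x , x∈H)
        with any? (λ u → any? (λ w → (u ∈? H) ×-dec (w ∈? H) ×-dec ¬? (Near? u w)))
      ... | yes (u , w , u∈H , w∈H , u#w) =
        let (y , y∈H , _ , y-simp) = simplicial-vertex-apart rec u∈H w∈H u#w in y , y∈H , y-simp
      ... | no no-apart-pair = x , x∈H , λ {u} {w} u∈H w∈H _ _ u≢w →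
        [ (λ u≡w → contradiction u≡w u≢w) , id ]′
          (decidable-stable (Near? u w) λ u#w → no-apart-pair (u , w , u∈H , w∈H , u#w))

      simplicial-vertex-apart : ∀ {H x c₀} → Acc _⊂_ H → x ∈ H → c₀ ∈ H → Apart x c₀ →
                                ∃[ y ] y ∈ H × Apart x y × Simplicial H y
      simplicial-vertex-apart {H} {x} {c₀} (acc smaller) x∈H c₀∈H x#c₀ = result
        where
        open Separation x∈H c₀∈H x#c₀

        in-C : ∀ {y} → y ∈ C → Simplicial (C ∪ S) y → ∃[ y ] y ∈ H × Apart x y × Simplicial H y
        in-C {y} y∈C y-simp = y , C⊆H y∈C , D-apart (C⊆D y∈C) , Simplicial-C y∈C y-simp

        result : ∃[ y ] y ∈ H × Apart x y × Simplicial H y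
        result with any? (λ s → any? (λ c → (s ∈? S) ×-dec (c ∈? C) ×-dec ¬? (Adj? s c)))
        ... | yes (s , c , s∈S , c∈C , s≁c) =
          let (y , y∈C∪S , s#y , y-simp) = simplicial-vertex-apart (smaller C∪S⊂H)
                (x∈p∪q⁺ (inj₂ s∈S)) (x∈p∪q⁺ (inj₁ c∈C)) [ S≢C s∈S c∈C , s≁c ]′
          in in-C (Apart-S⇒∈C s∈S y∈C∪S s#y) y-simp
        ... | no S≁C =
          let (y , y∈C , y-simp) = simplicial-vertex (smaller C⊂H) (c₀ , c₀∈C)
          in in-C y∈C (Simplicial-∪ y-simp S-clique S~C)
          where
          S~C : ∀ {s c} → s ∈ S → c ∈ C → Adj G s c
          S~C {s} {c} s∈S c∈C = decidable-stable (Adj? s c) λ s≁c → S≁C (s , c , s∈S , c∈C , s≁c)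

  Chordal⇒HasSimplicialVertices : Chordal G → HasSimplicialVertices
  Chordal⇒HasSimplicialVertices chordal {W} = simplicial-vertex chordal (⊂-wellFounded W)

theorem1p5 : (m : ℕ) (G : Graph m) → Chordal G → (n : ℕ) → 1 ≤ n →
    CollapsibilityAtMost (I n G) (n ∸ 1)
theorem1p5 m G chordal (suc n) _ =
  n , ≤-refl , Collapsible-I G (Chordal⇒HasSimplicialVertices G chordal) n
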